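{- Let $F$ be a digraph and let $a=xy$ be an arc of $F$. If $F-a$ is $\vec{\chi}$-maderian, then $F$ is $\vec{\chi}$-maderian and $\mathrm{mad}_{\vec{\chi}}(F)\le 4\,\mathrm{mad}_{\vec{\chi}}(F-a)-3$.
   Context: Digraphs are finite, without loops or parallel arcs. The dichromatic number $\vec{\chi}(D)$ is the least $k$ such that $V(D)$ can be partitioned into $k$ sets each inducing an acyclic subdigraph. A subdivision of $F$ is obtained by replacing each arc $(u,v)$ by a directed $(u,v)$-path of length at least 1, internally disjoint; $D$ contains a subdivision of $F$ if some subdigraph of $D$ is one. $F$ is $\vec{\chi}$-maderian if there is an integer $c$ such that every digraph $D$ with $\vec{\chi}(D)\ge c$ contains a subdivision of $F$; the least such $c$ is $\mathrm{mad}_{\vec{\chi}}(F)$. -}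

module Defs where

open import Data.Nat using (ℕ; _<_; _≤_; _*_; _∸_)
open import Data.Fin using (Fin; _≟_)
open import Data.Bool using (Bool; true; false; _∧_; not)
open import Data.Bool.Properties using (∧-zeroʳ)
open import Data.List using (List; []; _∷_; _++_)
open import Data.List.Membership.Propositional using (_∈_)
open import Data.List.Relation.Unary.Unique.Propositional using (Unique)
open import Data.Product using (Σ; _×_; _,_)
open import Relation.Nullary using (¬_)
open import Relation.Nullary.Decidable using (⌊_⌋)
open import Relation.Binary.PropositionalEquality using (_≡_; refl; cong)
open import Function.Definitions using (Injective)

record Digraph : Set where
  field
    n        : ℕ
    arc      : Fin n → Fin n → Bool
    loopless : ∀ v → arc v v ≡ false
open Digraph public

data Walk (D : Digraph) (S : Fin (n D) → Set) : Fin (n D) → Fin (n D) → Set where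
  edge : ∀ {u v} → S u → S v → arc D u v ≡ true → Walk D S u v
  cons : ∀ {u v w} → S u → arc D u v ≡ true → Walk D S v w → Walk D S u w

-- S induces an acyclic subdigraph: no directed cycle (= no nonempty closed walk).
Acyclic : (D : Digraph) → (Fin (n D) → Set) → Set
Acyclic D S = ∀ v → ¬ Walk D S v v

Dicolourable : Digraph → ℕ → Set
Dicolourable D k = Σ (Fin (n D) → Fin k) λ c → ∀ (i : Fin k) → Acyclic D (λ v → c v ≡ i)

DichromaticAtLeast : Digraph → ℕ → Set
DichromaticAtLeast D c = ∀ k → k < c → ¬ Dicolourable D k

IsPathThrough : (D : Digraph) → Fin (n D) → List (Fin (n D)) → Fin (n D) → Set
IsPathThrough D x []       y = arc D x y ≡ true
IsPathThrough D x (z ∷ zs) y = (arc D x z ≡ true) × IsPathThrough D z zs y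

record ContainsSubdivision (F D : Digraph) : Set where
  field
    φ      : Fin (n F) → Fin (n D)
    φ-inj  : Injective _≡_ _≡_ φ
    P      : (a b : Fin (n F)) → arc F a b ≡ true → List (Fin (n D))
    path   : ∀ a b (e : arc F a b ≡ true) → IsPathThrough D (φ a) (P a b e) (φ b)
    unique : ∀ a b (e : arc F a b ≡ true) → Unique (P a b e)
    avoid  : ∀ a b (e : arc F a b ≡ true) (w : Fin (n D)) → w ∈ P a b e →
             ∀ v → ¬ (w ≡ φ v)
    disj   : ∀ a b (e : arc F a b ≡ true) a' b' (e' : arc F a' b' ≡ true) →
             ¬ ((a ≡ a') × (b ≡ b')) →
             ∀ w → w ∈ P a b e → ¬ (w ∈ P a' b' e')

Forces : Digraph → ℕ → Set
Forces F c = ∀ (D : Digraph) → DichromaticAtLeast D c → ContainsSubdivision F D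

Maderian : Digraph → Set
Maderian F = Σ ℕ λ c → Forces F c

IsMad : Digraph → ℕ → Set
IsMad F c = Forces F c × (∀ c' → Forces F c' → c ≤ c')

private
  del-loopless : (F : Digraph) (x y : Fin (n F)) → ∀ v →
    (arc F v v ∧ not (⌊ v ≟ x ⌋ ∧ ⌊ v ≟ y ⌋)) ≡ false
  del-loopless F x y v rewrite loopless F v = refl

deleteArc : (F : Digraph) → Fin (n F) → Fin (n F) → Digraph
deleteArc F x y = record
  { n        = n F
  ; arc      = λ u v → arc F u v ∧ not (⌊ u ≟ x ⌋ ∧ ⌊ v ≟ y ⌋)
  ; loopless = del-loopless F x y
  }

-- Let c = mad(F − xy) and let D have dichromatic number at least 4c − 3.  In each strong
-- component of D fix a root r, and give every vertex v its out-level dist(r, v) and its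
-- in-level dist(v, r).  Along an arc inside a component each level changes by at most one,
-- so an arc joining two vertices whose levels have the same parities cannot raise the
-- out-level or lower the in-level; hence a cycle that is monochromatic for the four parity
-- colours stays within one class (component, out-level, in-level).  Were every class
-- (c − 1)-dicolourable, D would be (4c − 4)-dicolourable, so some class contains a
-- subdivision of F − xy (dicolourability is decidable, so this class can be found).  The arc
-- xy is then routed from the image of x back to r along a shortest path and on to the image
-- of y along a shortest path; the inner vertices of these paths have smaller levels than the
-- class, so they avoid it.

module Submission where

open import Defs
open import Data.Nat using (ℕ; zero; suc; _≤_; _<_; _*_; _∸_; _+_; z≤n; s≤s; _≤?_)
open import Data.Nat.Properties
  using (≤-refl; ≤-trans; ≤-antisym; ≤-reflexive; <-irrefl; <⇒≤; ≰⇒>; n≤1+n; m≤n⇒m≤1+n; <-≤-trans;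
         m≤n⇒m<n∨m≡n; n≤0⇒n≡0; *-suc)
open import Data.Fin using (Fin; zero; suc; _≟_; toℕ; fromℕ<; combine; inject≤; opposite)
open import Data.Fin.Properties using (any?; all?; toℕ-fromℕ<; fromℕ<-cong; combine-injective; inject≤-injective)
open import Data.Bool using (Bool; true; false; _∧_; _∨_; if_then_else_)
import Data.Bool.Properties as Bool
open import Data.Maybe using (Maybe; just; nothing; fromMaybe) renaming (map to mapMaybe)
open import Data.Product using (Σ; ∃; _×_; _,_; proj₁; proj₂)
open import Data.Product.Properties using (≡-dec)
open import Data.Sum using (_⊎_; inj₁; inj₂)
open import Data.Empty using (⊥; ⊥-elim)
open import Data.List using (List; []; _∷_; _++_; [_]; map; reverse; length; lookup; filter; allFin)
open import Data.List.Properties using (unfold-reverse)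
open import Data.List.Relation.Unary.All using (All; []; _∷_)
import Data.List.Relation.Unary.All as All
open import Data.List.Relation.Unary.All.Properties using (++⁺)
open import Data.List.Relation.Unary.Any using (here; there; index)
open import Data.List.Relation.Unary.Any.Properties using (lookup-index; reverse⁻)
open import Data.List.Membership.Propositional using (_∈_; _∉_)
open import Data.List.Membership.Propositional.Properties
  using (∈-filter⁺; ∈-filter⁻; ∈-allFin; ∈-lookup; ∈-map⁻; ∈-∃++; ∈-++⁻; ∈-++⁺ʳ)
open import Data.List.Relation.Unary.Unique.Propositional using (Unique)
open import Data.List.Relation.Unary.Unique.Propositional.Properties using (map⁺; filter⁺; allFin⁺)
open import Data.List.Relation.Unary.AllPairs using ([]; _∷_)
open import Function using (_∘_)
open import Relation.Nullary using (¬_; Dec; yes; no; contradiction)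
open import Relation.Nullary.Decidable using (⌊_⌋; _×-dec_; ¬?; decidable-stable)
open import Relation.Binary using (DecidableEquality)
open import Relation.Binary.PropositionalEquality using (_≡_; _≢_; refl; sym; trans; cong; cong₂; subst; module ≡-Reasoning)
import Axiom.UniquenessOfIdentityProofs as UIP
import Data.Vec.Functional as Vector
import Data.List.Membership.DecPropositional as DecMembership

∨-true⁻ : ∀ {a b} → a ∨ b ≡ true → a ≡ true ⊎ b ≡ true
∨-true⁻ {true}  _ = inj₁ refl
∨-true⁻ {false} p = inj₂ p

∨-trueˡ : ∀ {a} b → a ≡ true → a ∨ b ≡ true
∨-trueˡ b refl = refl

∨-trueʳ : ∀ a {b} → b ≡ true → a ∨ b ≡ true
∨-trueʳ true  _ = refl
∨-trueʳ false p = p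

∧-true⁻ : ∀ {a b} → a ∧ b ≡ true → a ≡ true × b ≡ true
∧-true⁻ {true} {true} _ = refl , refl

∧-true⁺ : ∀ {a b} → a ≡ true → b ≡ true → a ∧ b ≡ true
∧-true⁺ refl refl = refl

true≢false : ∀ {a} → a ≡ true → a ≡ false → ⊥
true≢false refl ()

⌊⌋-true⁻ : ∀ {p} {P : Set p} (d : Dec P) → ⌊ d ⌋ ≡ true → P
⌊⌋-true⁻ (yes p) _ = p

⌊⌋-true⁺ : ∀ {p} {P : Set p} (d : Dec P) → P → ⌊ d ⌋ ≡ true
⌊⌋-true⁺ (yes _) _ = refl
⌊⌋-true⁺ (no ¬p) p = contradiction p ¬p

_⊆ᵇ_ : ∀ {m} → (Fin m → Bool) → (Fin m → Bool) → Set
Q ⊆ᵇ Q′ = ∀ v → Q v ≡ true → Q′ v ≡ true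

count : ∀ {m} → (Fin m → Bool) → ℕ
count {zero}  Q = 0
count {suc m} Q = (if Q zero then 1 else 0) + count (λ i → Q (suc i))

count≤ : ∀ {m} (Q : Fin m → Bool) → count Q ≤ m
count≤ {zero}  Q = z≤n
count≤ {suc m} Q with Q zero
... | true  = s≤s (count≤ (λ i → Q (suc i)))
... | false = m≤n⇒m≤1+n (count≤ (λ i → Q (suc i)))

count-mono : ∀ {m} {Q Q′ : Fin m → Bool} → Q ⊆ᵇ Q′ → count Q ≤ count Q′
count-mono {zero}  _ = z≤n
count-mono {suc m} {Q} {Q′} Q⊆Q′ with Q zero in q | Q′ zero in q′
... | true  | true  = s≤s (count-mono (λ v → Q⊆Q′ (suc v)))
... | false | true  = m≤n⇒m≤1+n (count-mono (λ v → Q⊆Q′ (suc v)))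
... | false | false = count-mono (λ v → Q⊆Q′ (suc v))
... | true  | false = contradiction q′ (true≢false (Q⊆Q′ zero q))

count-strict : ∀ {m} {Q Q′ : Fin m → Bool} → Q ⊆ᵇ Q′ →
               ∀ v → Q v ≡ false → Q′ v ≡ true → count Q < count Q′
count-strict {suc m} {Q} {Q′} Q⊆Q′ zero Qv Q′v rewrite Qv | Q′v = s≤s (count-mono (λ v → Q⊆Q′ (suc v)))
count-strict {suc m} {Q} {Q′} Q⊆Q′ (suc v) Qv Q′v with Q zero in q | Q′ zero in q′
... | true  | true  = s≤s (count-strict (λ v → Q⊆Q′ (suc v)) v Qv Q′v)
... | false | true  = s≤s (<⇒≤ (count-strict (λ v → Q⊆Q′ (suc v)) v Qv Q′v))
... | false | false = count-strict (λ v → Q⊆Q′ (suc v)) v Qv Q′v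
... | true  | false = contradiction q′ (true≢false (Q⊆Q′ zero q))

⊆ᵇ-or-new : ∀ {m} (Q Q′ : Fin m → Bool) → Q ⊆ᵇ Q′ ⊎ ∃ λ v → Q v ≡ true × Q′ v ≡ false
⊆ᵇ-or-new {zero}  Q Q′ = inj₁ (λ ())
⊆ᵇ-or-new {suc m} Q Q′ with ⊆ᵇ-or-new (λ i → Q (suc i)) (λ i → Q′ (suc i))
... | inj₂ (v , Qv , Q′v) = inj₂ (suc v , Qv , Q′v)
... | inj₁ tail with Q zero in q | Q′ zero in q′
... | true  | false = inj₂ (zero , q , q′)
... | true  | true  = inj₁ λ { zero _ → q′ ; (suc v) → tail v }
... | false | _     = inj₁ λ { zero p → contradiction q (true≢false p) ; (suc v) → tail v }

module Closure {m : ℕ} (A : Fin m → Fin m → Bool) (S : Fin m → Bool) where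

  grow : (Fin m → Bool) → Fin m → Bool
  grow Q v = Q v ∨ (S v ∧ ⌊ any? (λ w → Q w ∧ A w v Bool.≟ true) ⌋)

  ball : (Fin m → Bool) → ℕ → Fin m → Bool
  ball Q zero    = Q
  ball Q (suc t) = grow (ball Q t)

  data Reach (Q : Fin m → Bool) : Fin m → Set where
    start  : ∀ {v} → Q v ≡ true → Reach Q v
    extend : ∀ {w v} → Reach Q w → A w v ≡ true → S v ≡ true → Reach Q v

  grow-true⁺ : ∀ Q {w v} → Q w ≡ true → A w v ≡ true → S v ≡ true → grow Q v ≡ true
  grow-true⁺ Q {w} {v} Qw Awv Sv =
    ∨-trueʳ (Q v) (∧-true⁺ Sv (⌊⌋-true⁺ (any? (λ w → Q w ∧ A w v Bool.≟ true)) (w , ∧-true⁺ Qw Awv)))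

  grow-true⁻ : ∀ Q {v} → grow Q v ≡ true →
               Q v ≡ true ⊎ ∃ λ w → Q w ≡ true × A w v ≡ true × S v ≡ true
  grow-true⁻ Q {v} p with ∨-true⁻ {Q v} p
  ... | inj₁ Qv = inj₁ Qv
  ... | inj₂ q with ∧-true⁻ {S v} q
  ... | Sv , any with ⌊⌋-true⁻ (any? (λ w → Q w ∧ A w v Bool.≟ true)) any
  ... | w , QA = inj₂ (w , proj₁ (∧-true⁻ QA) , proj₂ (∧-true⁻ QA) , Sv)

  grow-⊇ : ∀ Q → Q ⊆ᵇ grow Q
  grow-⊇ Q v = ∨-trueˡ _

  grow-mono : ∀ {Q Q′} → Q ⊆ᵇ Q′ → grow Q ⊆ᵇ grow Q′
  grow-mono {Q} {Q′} Q⊆Q′ v p with grow-true⁻ Q p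
  ... | inj₁ Qv                = grow-⊇ Q′ v (Q⊆Q′ v Qv)
  ... | inj₂ (w , Qw , Awv , Sv) = grow-true⁺ Q′ (Q⊆Q′ w Qw) Awv Sv

  ball-mono : ∀ Q {s t} → s ≤ t → ball Q s ⊆ᵇ ball Q t
  ball-mono Q {zero}  {zero}  _         v p = p
  ball-mono Q {zero}  {suc t} _         v p = grow-⊇ (ball Q t) v (ball-mono Q {0} {t} z≤n v p)
  ball-mono Q {suc s} {suc t} (s≤s s≤t) = grow-mono (ball-mono Q s≤t)

  ball-stationary : ∀ Q t → ball Q (suc t) ⊆ᵇ ball Q t → ∀ s → ball Q s ⊆ᵇ ball Q t
  ball-stationary Q t stat zero    = ball-mono Q {0} {t} z≤n
  ball-stationary Q t stat (suc s) v p = stat v (grow-mono (ball-stationary Q t stat s) v p)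

  ball-grows-or-stationary : ∀ Q t → t ≤ count (ball Q t) ⊎ (∀ s → ball Q s ⊆ᵇ ball Q t)
  ball-grows-or-stationary Q zero = inj₁ z≤n
  ball-grows-or-stationary Q (suc t) with ball-grows-or-stationary Q t
  ... | inj₂ stat = inj₂ (λ s v p → grow-⊇ _ v (stat s v p))
  ... | inj₁ t≤count with ⊆ᵇ-or-new (ball Q (suc t)) (ball Q t)
  ... | inj₁ stat = inj₂ (λ s v p → grow-⊇ _ v (ball-stationary Q t stat s v p))
  ... | inj₂ (v , new , old) =
        inj₁ (<-≤-trans (s≤s t≤count) (count-strict (grow-⊇ (ball Q t)) v old new))

  ball-saturated : ∀ Q s → ball Q s ⊆ᵇ ball Q (suc m)
  ball-saturated Q s v with ball-grows-or-stationary Q (suc m)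
  ... | inj₂ stat = stat s v
  ... | inj₁ m<count = contradiction (≤-trans m<count (count≤ (ball Q (suc m)))) (<-irrefl refl)

  ball-sound : ∀ {Q} t {v} → ball Q t v ≡ true → Reach Q v
  ball-sound zero p = start p
  ball-sound {Q} (suc t) p with grow-true⁻ (ball Q t) p
  ... | inj₁ q                   = ball-sound t q
  ... | inj₂ (w , q , Awv , Sv) = extend (ball-sound t q) Awv Sv

  reach-ball : ∀ {Q v} → Reach Q v → ∃ λ t → ball Q t v ≡ true
  reach-ball (start p) = 0 , p
  reach-ball {Q} (extend r Awv Sv) with reach-ball r
  ... | t , p = suc t , grow-true⁺ (ball Q t) p Awv Sv

  ball-complete : ∀ {Q v} → Reach Q v → ball Q (suc m) v ≡ true
  ball-complete {Q} {v} r with reach-ball r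
  ... | t , p = ball-saturated Q t v p

walk-map : ∀ {G : Digraph} {S S′ : Fin (n G) → Set} → (∀ {v} → S v → S′ v) →
           ∀ {u w} → Walk G S u w → Walk G S′ u w
walk-map f (edge Su Sv a)  = edge (f Su) (f Sv) a
walk-map f (cons Su a wlk) = cons (f Su) a (walk-map f wlk)

walk-head : ∀ {G : Digraph} {S : Fin (n G) → Set} {u w} → Walk G S u w → S u
walk-head (edge Su _ _) = Su
walk-head (cons Su _ _) = Su

walk-snoc : ∀ {G : Digraph} {S : Fin (n G) → Set} {u v w} →
            Walk G S u v → arc G v w ≡ true → S w → Walk G S u w
walk-snoc (edge Su Sv a)  b Sw = cons Su a (edge Sv Sw b)
walk-snoc (cons Su a wlk) b Sw = cons Su a (walk-snoc wlk b Sw)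

module _ (G : Digraph) (S : Fin (n G) → Bool) where
  open Closure (arc G) S

  private
    outNeighbours : Fin (n G) → Fin (n G) → Bool
    outNeighbours u w = S w ∧ arc G u w

    reach-cons : ∀ {u v w} → arc G u v ≡ true → S v ≡ true →
                 Reach (outNeighbours v) w → Reach (outNeighbours u) w
    reach-cons a Sv (start q)        = extend (start (∧-true⁺ Sv a)) (proj₂ (∧-true⁻ q)) (proj₁ (∧-true⁻ q))
    reach-cons a Sv (extend r b Sw) = extend (reach-cons a Sv r) b Sw

    walk⇒reach : ∀ {u w} → Walk G (λ v → S v ≡ true) u w → Reach (outNeighbours u) w
    walk⇒reach (edge _ Sw a)   = start (∧-true⁺ Sw a)
    walk⇒reach (cons _ a wlk) = reach-cons a (walk-head wlk) (walk⇒reach wlk)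

    reach⇒walk : ∀ {u w} → S u ≡ true → Reach (outNeighbours u) w → Walk G (λ v → S v ≡ true) u w
    reach⇒walk Su (start q)        = edge Su (proj₁ (∧-true⁻ q)) (proj₂ (∧-true⁻ q))
    reach⇒walk Su (extend r b Sw) = walk-snoc (reach⇒walk Su r) b Sw

  closedWalk? : ∀ v → Dec (Walk G (λ v → S v ≡ true) v v)
  closedWalk? v = decide (S v) refl (ball (outNeighbours v) (suc (n G)) v) refl
    where
      decide : ∀ s → S v ≡ s → ∀ b → ball (outNeighbours v) (suc (n G)) v ≡ b →
               Dec (Walk G (λ v → S v ≡ true) v v)
      decide false Sv _     _ = no λ wlk → true≢false (walk-head wlk) Sv
      decide true  Sv true  b = yes (reach⇒walk Sv (ball-sound (suc (n G)) b))
      decide true  Sv false b = no λ wlk → true≢false (ball-complete (walk⇒reach wlk)) b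

acyclic? : ∀ (G : Digraph) {k} (col : Fin (n G) → Fin k) i → Dec (Acyclic G (λ v → col v ≡ i))
acyclic? G col i with all? (λ v → ¬? (closedWalk? G (λ u → ⌊ col u ≟ i ⌋) v))
... | yes acyc = yes λ v wlk → acyc v (walk-map (⌊⌋-true⁺ (col _ ≟ i)) wlk)
... | no ¬acyc = no λ acyc → ¬acyc λ v wlk → acyc v (walk-map (⌊⌋-true⁻ (col _ ≟ i)) wlk)

-- P must respect pointwise equality, as function extensionality is not available.
∃-function? : ∀ m {k} (P : (Fin m → Fin k) → Set) → (∀ {f g} → (∀ i → f i ≡ g i) → P f → P g) →
              (∀ f → Dec (P f)) → Dec (∃ P)
∃-function? zero P resp P? with P? (λ ())
... | yes p = yes (_ , p)
... | no ¬p = no λ (f , Pf) → ¬p (resp (λ ()) Pf)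
∃-function? (suc m) P resp P?
  with any? (λ a → ∃-function? m (λ g → P (a Vector.∷ g))
                     (λ eq → resp λ { zero → refl ; (suc i) → eq i }) (λ g → P? (a Vector.∷ g)))
... | yes (a , g , p) = yes (a Vector.∷ g , p)
... | no ¬p = no λ (f , Pf) →
        ¬p (f zero , Vector.tail f , resp (λ { zero → refl ; (suc i) → refl }) Pf)

dicolourable? : ∀ (G : Digraph) k → Dec (Dicolourable G k)
dicolourable? G k = ∃-function? (n G) _ resp (λ col → all? (acyclic? G col))
  where
    resp : ∀ {f g : Fin (n G) → Fin k} → (∀ v → f v ≡ g v) →
           (∀ i → Acyclic G (λ v → f v ≡ i)) → ∀ i → Acyclic G (λ v → g v ≡ i)
    resp f≗g acyc i v wlk = acyc i v (walk-map (trans (f≗g _)) wlk)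

dicolourable-mono : ∀ (G : Digraph) {k k′} → k ≤ k′ → Dicolourable G k → Dicolourable G k′
dicolourable-mono G k≤k′ (col , acyc) =
  (λ v → inject≤ (col v) k≤k′) ,
  λ i v wlk → acyc (col v) v (walk-map (λ p → inject≤-injective k≤k′ k≤k′ _ _ (trans p (sym (walk-head wlk)))) wlk)

converse : Digraph → Digraph
converse G = record { n = n G ; arc = λ u v → arc G v u ; loopless = loopless G }

unique-suffix : ∀ {A : Set} zs {a : A} ws → Unique (zs ++ a ∷ ws) → Unique ws × a ∉ ws
unique-suffix []       ws (a∉ ∷ uniq) = uniq , λ a∈ → All.lookup a∉ a∈ refl
unique-suffix (z ∷ zs) ws (_ ∷ uniq)   = unique-suffix zs ws uniq

module _ (G : Digraph) where

  path-snoc : ∀ {a b c} zs → IsPathThrough G a zs b → arc G b c ≡ true → IsPathThrough G a (zs ++ [ b ]) c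
  path-snoc []       ab        bc = ab , bc
  path-snoc (z ∷ zs) (az , zb) bc = az , path-snoc zs zb bc

  path-++ : ∀ {a b c} zs ws → IsPathThrough G a zs b → IsPathThrough G b ws c → IsPathThrough G a (zs ++ b ∷ ws) c
  path-++ []       ws ab        bc = ab , bc
  path-++ (z ∷ zs) ws (az , zb) bc = az , path-++ zs ws zb bc

  path-reverse : ∀ {a b} zs → IsPathThrough (converse G) a zs b → IsPathThrough G b (reverse zs) a
  path-reverse []       ba = ba
  path-reverse (z ∷ zs) (za , bz) rewrite unfold-reverse z zs = path-snoc (reverse zs) (path-reverse zs bz) za

  path-suffix : ∀ {a b c} zs ws → IsPathThrough G a (zs ++ b ∷ ws) c → IsPathThrough G b ws c
  path-suffix []       ws (_ , bc) = bc
  path-suffix (z ∷ zs) ws (_ , zc) = path-suffix zs ws zc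

  SimplePath : Fin (n G) → List (Fin (n G)) → Fin (n G) → Set
  SimplePath a zs b = IsPathThrough G a zs b × Unique zs × a ∉ zs × b ∉ zs

  open DecMembership (_≟_ {n G}) using (_∈?_)

  -- Shortcut the walk at the last visit of a.
  simple-path : ∀ a zs b → IsPathThrough G a zs b → a ≢ b →
                ∃ λ zs′ → SimplePath a zs′ b × (∀ {w} → w ∈ zs′ → w ∈ zs)
  simple-path a []       b ab _ = [] , (ab , [] , (λ ()) , (λ ())) , λ ()
  simple-path a (z ∷ zs) b (az , zb) a≢b with z ≟ b
  ... | yes refl = [] , (az , [] , (λ ()) , (λ ())) , λ ()
  ... | no z≢b = prepend (simple-path z zs b zb z≢b)
    where
      prepend : ∃ (λ zs′ → SimplePath z zs′ b × (∀ {w} → w ∈ zs′ → w ∈ zs)) →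
                ∃ λ zs′ → SimplePath a zs′ b × (∀ {w} → w ∈ zs′ → w ∈ z ∷ zs)
      prepend (zs′ , (zb′ , uniq , z∉ , b∉) , ⊆zs) with a ∈? zs′
      ... | yes a∈ with ∈-∃++ a∈
      ...   | pre , post , refl =
              post , (path-suffix pre post zb′ , proj₁ (unique-suffix pre post uniq) , proj₂ (unique-suffix pre post uniq) ,
                     b∉ ∘ ∈-++⁺ʳ pre ∘ there) ,
              there ∘ ⊆zs ∘ ∈-++⁺ʳ pre ∘ there
      prepend (zs′ , (zb′ , uniq , z∉ , b∉) , ⊆zs) | no a∉ =
        z ∷ zs′ ,
        ((az , zb′) , All.tabulate (λ w∈ z≡w → z∉ (subst (_∈ zs′) (sym z≡w) w∈)) ∷ uniq ,
         (λ { (here refl) → true≢false az (loopless G a) ; (there a∈) → a∉ a∈ }) ,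
         (λ { (here refl) → z≢b refl ; (there b∈) → b∉ b∈ })) ,
        λ { (here w≡z) → here w≡z ; (there w∈) → there (⊆zs w∈) }

-- The least t ≤ N with f t ≡ true; the junk value N when there is none.
least : (ℕ → Bool) → ℕ → ℕ
least f zero    = 0
least f (suc N) = if f 0 then 0 else suc (least (f ∘ suc) N)

least≤ : ∀ (f : ℕ → Bool) N → least f N ≤ N
least≤ f zero    = z≤n
least≤ f (suc N) with f 0
... | true  = z≤n
... | false = s≤s (least≤ (f ∘ suc) N)

least-minimal : ∀ (f : ℕ → Bool) N {t} → f t ≡ true → t ≤ N → least f N ≤ t
least-minimal f zero    {zero}  _  _         = z≤n
least-minimal f (suc N) {zero}  ft _         with f 0
... | true  = z≤n
... | false = ⊥-elim (true≢false ft refl)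
least-minimal f (suc N) {suc t} ft (s≤s t≤N) with f 0
... | true  = z≤n
... | false = s≤s (least-minimal (f ∘ suc) N ft t≤N)

least-true : ∀ (f : ℕ → Bool) N {t} → f t ≡ true → t ≤ N → f (least f N) ≡ true
least-true f zero    {zero}  ft _ = ft
least-true f (suc N) {zero}  ft _ with f 0 in f0
... | true  = f0
... | false = ⊥-elim (true≢false ft refl)
least-true f (suc N) {suc t} ft (s≤s t≤N) with f 0 in f0
... | true  = f0
... | false = least-true (f ∘ suc) N ft t≤N

module Distance (G : Digraph) where
  open Closure (arc G) (λ _ → true) using (Reach; start; extend; ball; ball-sound; ball-complete; grow-true⁺; grow-true⁻)

  V : Set
  V = Fin (n G)

  source : V → V → Bool
  source r w = ⌊ w ≟ r ⌋

  infix 4 _⇝_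
  _⇝_ : V → V → Set
  r ⇝ v = Reach (source r) v

  reachedAt : V → V → ℕ → Bool
  reachedAt r v t = ball (source r) t v

  dist : V → V → ℕ
  dist r v = least (reachedAt r v) (suc (n G))

  ⇝⇒reachedAt : ∀ {r v} → r ⇝ v → reachedAt r v (suc (n G)) ≡ true
  ⇝⇒reachedAt = ball-complete

  reachedAt⇒⇝ : ∀ {r v} t → reachedAt r v t ≡ true → r ⇝ v
  reachedAt⇒⇝ t = ball-sound t

  ⇝-refl : ∀ r → r ⇝ r
  ⇝-refl r = start (⌊⌋-true⁺ (r ≟ r) refl)

  ⇝-trans : ∀ {a b c} → a ⇝ b → b ⇝ c → a ⇝ c
  ⇝-trans {b = b} ab (start c≡b) with ⌊⌋-true⁻ (_ ≟ b) c≡b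
  ... | refl = ab
  ⇝-trans ab (extend bw wc _) = extend (⇝-trans ab bw) wc refl

  ⇝-snoc : ∀ {a b c} → a ⇝ b → arc G b c ≡ true → a ⇝ c
  ⇝-snoc ab bc = extend ab bc refl

  ⇝-cons : ∀ {a b c} → arc G a b ≡ true → b ⇝ c → a ⇝ c
  ⇝-cons ab bc = ⇝-trans (⇝-snoc (⇝-refl _) ab) bc

  walk⇒⇝ : ∀ {S u w} → Walk G S u w → u ⇝ w
  walk⇒⇝ (edge _ _ a)   = ⇝-snoc (⇝-refl _) a
  walk⇒⇝ (cons _ a wlk) = ⇝-cons a (walk⇒⇝ wlk)

  dist≤ : ∀ r v → dist r v ≤ suc (n G)
  dist≤ r v = least≤ (reachedAt r v) (suc (n G))

  ball-dist : ∀ {r v} → r ⇝ v → ball (source r) (dist r v) v ≡ true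
  ball-dist {r} {v} r⇝v = least-true (reachedAt r v) (suc (n G)) (ball-complete r⇝v) ≤-refl

  dist-minimal : ∀ {r v} t → ball (source r) t v ≡ true → dist r v ≤ t
  dist-minimal {r} {v} t p with t ≤? suc (n G)
  ... | yes t≤N = least-minimal (reachedAt r v) (suc (n G)) p t≤N
  ... | no  t≰N = ≤-trans (dist≤ r v) (<⇒≤ (≰⇒> t≰N))

  dist-self : ∀ r → dist r r ≡ 0
  dist-self r = n≤0⇒n≡0 (dist-minimal 0 (⌊⌋-true⁺ (r ≟ r) refl))

  dist-zero : ∀ {r v} → r ⇝ v → dist r v ≡ 0 → v ≡ r
  dist-zero {r} {v} r⇝v d≡0 = ⌊⌋-true⁻ (v ≟ r) (subst (λ t → ball (source r) t v ≡ true) d≡0 (ball-dist r⇝v))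

  dist-arc : ∀ {r u v} → r ⇝ u → arc G u v ≡ true → dist r v ≤ suc (dist r u)
  dist-arc {r} {u} {v} r⇝u uv = dist-minimal (suc (dist r u)) (grow-true⁺ _ (ball-dist r⇝u) uv refl)

  ShortPath : V → ℕ → V → Set
  ShortPath r t v = ∃ λ zs → IsPathThrough G r zs v × All (λ z → dist r z < t) zs

  ball-path : ∀ r t {v} → ball (source r) t v ≡ true → v ≡ r ⊎ ShortPath r t v
  ball-path r zero    {v} p = inj₁ (⌊⌋-true⁻ (v ≟ r) p)
  ball-path r (suc t) {v} p with grow-true⁻ (ball (source r) t) p
  ... | inj₁ q with ball-path r t q
  ...   | inj₁ v≡r              = inj₁ v≡r
  ...   | inj₂ (zs , rv , near) = inj₂ (zs , rv , All.map (λ d<t → ≤-trans d<t (n≤1+n _)) near)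
  ball-path r (suc t) {v} p | inj₂ (w , q , wv , _) with ball-path r t q
  ... | inj₁ refl             = inj₂ ([] , wv , [])
  ... | inj₂ (zs , rw , near) =
        inj₂ (zs ++ [ w ] , path-snoc G zs rw wv ,
              ++⁺ (All.map (λ d<t → ≤-trans d<t (n≤1+n _)) near) (s≤s (dist-minimal t q) ∷ []))

  shortest-path : ∀ {r v} → r ⇝ v → v ≢ r → ShortPath r (dist r v) v
  shortest-path {r} r⇝v v≢r with ball-path r _ (ball-dist r⇝v)
  ... | inj₁ v≡r = contradiction v≡r v≢r
  ... | inj₂ sp  = sp

⇝-converse : ∀ (G : Digraph) {u v} → Distance._⇝_ G u v → Distance._⇝_ (converse G) v u
⇝-converse G {u} (Closure.start v≡u) with ⌊⌋-true⁻ (_ ≟ u) v≡u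
... | refl = Distance.⇝-refl (converse G) u
⇝-converse G (Closure.extend u⇝w wv _) = Distance.⇝-cons (converse G) wv (⇝-converse G u⇝w)

lookup-injective : ∀ {A : Set} (xs : List A) → Unique xs → ∀ {i j} → lookup xs i ≡ lookup xs j → i ≡ j
lookup-injective (x ∷ xs) _          {zero}  {zero}  _  = refl
lookup-injective (x ∷ xs) (x∉ ∷ _)   {zero}  {suc j} eq = ⊥-elim (All.lookup x∉ (∈-lookup j) eq)
lookup-injective (x ∷ xs) (x∉ ∷ _)   {suc i} {zero}  eq = ⊥-elim (All.lookup x∉ (∈-lookup i) (sym eq))
lookup-injective (x ∷ xs) (_ ∷ uniq) {suc i} {suc j} eq = cong suc (lookup-injective xs uniq eq)

module Fibre (D : Digraph) {A : Set} (_≟A_ : DecidableEquality A) (f : Fin (n D) → A) (a : A) where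

  members : List (Fin (n D))
  members = filter (λ v → f v ≟A a) (allFin (n D))

  induced : Digraph
  induced = record
    { n        = length members
    ; arc      = λ i j → arc D (lookup members i) (lookup members j)
    ; loopless = λ i → loopless D (lookup members i)
    }

  ι : Fin (n induced) → Fin (n D)
  ι = lookup members

  ι-injective : ∀ {i j} → ι i ≡ ι j → i ≡ j
  ι-injective = lookup-injective members (filter⁺ (λ v → f v ≟A a) (allFin⁺ (n D)))

  ι-fibre : ∀ i → f (ι i) ≡ a
  ι-fibre i = proj₂ (∈-filter⁻ (λ v → f v ≟A a) {xs = allFin (n D)} (∈-lookup {xs = members} i))

  index-of : ∀ v → f v ≡ a → Fin (n induced)
  index-of v fv≡a = index (∈-filter⁺ (λ v → f v ≟A a) (∈-allFin v) fv≡a)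

  ι-index-of : ∀ v fv≡a → ι (index-of v fv≡a) ≡ v
  ι-index-of v fv≡a = sym (lookup-index (∈-filter⁺ (λ v → f v ≟A a) (∈-allFin v) fv≡a))

  index-of-irrelevant : ∀ v p q → index-of v p ≡ index-of v q
  index-of-irrelevant v p q = cong (index-of v) (UIP.Decidable⇒UIP.≡-irrelevant _≟A_ p q)

  module _ {k} (col : Fin (n induced) → Fin k) (i : Fin k) where

    Coloured : Fin (n D) → Set
    Coloured v = Σ (f v ≡ a) λ p → col (index-of v p) ≡ i

    private
      coloured-index : ∀ {v} → Coloured v → (p : f v ≡ a) → col (index-of v p) ≡ i
      coloured-index {v} (p′ , c) p = trans (cong col (index-of-irrelevant v p p′)) c

      arc-index : ∀ {u v} → arc D u v ≡ true → (p : f u ≡ a) (q : f v ≡ a) → arc induced (index-of u p) (index-of v q) ≡ true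
      arc-index {u} {v} uv p q rewrite ι-index-of u p | ι-index-of v q = uv

    walk-index : ∀ {u w} → Walk D Coloured u w → (p : f u ≡ a) (q : f w ≡ a) →
                 Walk induced (λ j → col j ≡ i) (index-of u p) (index-of w q)
    walk-index (edge Cu Cw uw)  p q = edge (coloured-index Cu p) (coloured-index Cw q) (arc-index uw p q)
    walk-index (cons Cu uv wlk) p q =
      cons (coloured-index Cu p) (arc-index uv p (proj₁ (walk-head wlk))) (walk-index wlk (proj₁ (walk-head wlk)) q)

    acyclic-lift : Acyclic induced (λ j → col j ≡ i) → Acyclic D Coloured
    acyclic-lift acyc v cycle = acyc _ (walk-index cycle (proj₁ (walk-head cycle)) (proj₁ (walk-head cycle)))

-- Colour v by the pair (κ v, its colour in a dicolouring of its fibre): by hypothesis a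
-- monochromatic cycle stays in one fibre, where it would be monochromatic for an acyclic colouring.
dicolourable-by-fibres :
  ∀ (D : Digraph) {A : Set} (_≟A_ : DecidableEquality A) (f : Fin (n D) → A) {m k} (κ : Fin (n D) → Fin m) →
  (∀ (C : Fin (n D) → Set) → (∀ {u w} → C u → C w → κ u ≡ κ w) →
   ∀ v → Walk D C v v → Walk D (λ z → C z × f z ≡ f v) v v) →
  (∀ a → Dicolourable (Fibre.induced D _≟A_ f a) k) → Dicolourable D (m * k)
dicolourable-by-fibres D _≟A_ f {m} {k} κ confined colours = colour , acyclic
  where
    open Fibre D _≟A_ f using (index-of; acyclic-lift)

    fibreColour : Fin (n D) → Fin k
    fibreColour v = proj₁ (colours (f v)) (index-of (f v) v refl)

    fibreColour-at : ∀ v {a} (p : f v ≡ a) → proj₁ (colours a) (index-of a v p) ≡ fibreColour v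
    fibreColour-at v refl = refl

    colour : Fin (n D) → Fin (m * k)
    colour v = combine (κ v) (fibreColour v)

    acyclic : ∀ c → Acyclic D (λ v → colour v ≡ c)
    acyclic c v cycle =
      acyclic-lift (f v) (proj₁ (colours (f v))) (fibreColour v) (proj₂ (colours (f v)) (fibreColour v)) v
        (walk-map (λ {z} (cz , fz≡fv) → fz≡fv , trans (fibreColour-at z fz≡fv) (proj₂ (same cz (walk-head cycle))))
                  (confined _ (λ cu cw → proj₁ (same cu cw)) v cycle))
      where
        same : ∀ {u w} → colour u ≡ c → colour w ≡ c → κ u ≡ κ w × fibreColour u ≡ fibreColour w
        same cu cw = combine-injective _ _ _ _ (trans cu (sym cw))

firstTrue : ∀ {m} → (Fin m → Bool) → Maybe (Fin m)
firstTrue {zero}  f = nothing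
firstTrue {suc m} f = if f zero then just zero else mapMaybe suc (firstTrue (f ∘ suc))

firstTrue-true : ∀ {m} (f : Fin m → Bool) {i} → f i ≡ true → ∃ λ j → firstTrue f ≡ just j × f j ≡ true
firstTrue-true {suc m} f {i} fi with f zero in f0
... | true = zero , refl , f0
firstTrue-true {suc m} f {zero}  fi | false = ⊥-elim (true≢false fi f0)
firstTrue-true {suc m} f {suc i} fi | false with firstTrue-true (f ∘ suc) fi
... | j , first≡j , fj rewrite first≡j = suc j , refl , fj

firstTrue-cong : ∀ {m} {f g : Fin m → Bool} → (∀ i → f i ≡ g i) → firstTrue f ≡ firstTrue g
firstTrue-cong {zero}          _   = refl
firstTrue-cong {suc m} {f} {g} f≗g rewrite f≗g zero | firstTrue-cong {f = f ∘ suc} {g ∘ suc} (f≗g ∘ suc) = refl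

true⇔⇒≡ : ∀ {a b} → (a ≡ true → b ≡ true) → (b ≡ true → a ≡ true) → a ≡ b
true⇔⇒≡ {true}          a⇒b _   = sym (a⇒b refl)
true⇔⇒≡ {false} {true}  _   b⇒a = b⇒a refl
true⇔⇒≡ {false} {false} _   _   = refl

parity : ℕ → Fin 2
parity zero    = zero
parity (suc k) = opposite (parity k)

parity-suc≢ : ∀ k → parity (suc k) ≢ parity k
parity-suc≢ k with parity k
... | zero     = λ ()
... | suc zero = λ ()

≤-suc-parity : ∀ {a b} → b ≤ suc a → parity a ≡ parity b → b ≤ a
≤-suc-parity {a} b≤1+a same with m≤n⇒m<n∨m≡n b≤1+a
... | inj₁ (s≤s b≤a) = b≤a
... | inj₂ refl      = contradiction (sym same) (parity-suc≢ a)

module Levels (D : Digraph) where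
  module Out = Distance D
  module In  = Distance (converse D)
  open Out using (V; _⇝_; ⇝-refl; ⇝-trans; ⇝-snoc; walk⇒⇝; ShortPath)

  strong : V → V → Bool
  strong u v = Out.reachedAt u v (suc (n D)) ∧ Out.reachedAt v u (suc (n D))

  strong⁺ : ∀ {u v} → u ⇝ v → v ⇝ u → strong u v ≡ true
  strong⁺ uv vu = ∧-true⁺ (Out.⇝⇒reachedAt uv) (Out.⇝⇒reachedAt vu)

  strong⁻ : ∀ {u v} → strong u v ≡ true → u ⇝ v × v ⇝ u
  strong⁻ {u} {v} s = Out.reachedAt⇒⇝ (suc (n D)) (proj₁ (∧-true⁻ {Out.reachedAt u v (suc (n D))} s)) ,
                    Out.reachedAt⇒⇝ (suc (n D)) (proj₂ (∧-true⁻ {Out.reachedAt u v (suc (n D))} s))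

  root : V → V
  root v = fromMaybe v (firstTrue (λ u → strong u v))

  root-strong : ∀ v → strong (root v) v ≡ true
  root-strong v with firstTrue-true (λ u → strong u v) (strong⁺ (⇝-refl v) (⇝-refl v))
  ... | j , first≡j , sj rewrite first≡j = sj

  root⇝ : ∀ v → root v ⇝ v
  root⇝ v = proj₁ (strong⁻ (root-strong v))

  ⇝root : ∀ v → v ⇝ root v
  ⇝root v = proj₂ (strong⁻ (root-strong v))

  root⇝ᶜ : ∀ v → In._⇝_ (root v) v
  root⇝ᶜ v = ⇝-converse D (⇝root v)

  root-cong : ∀ {u v} → u ⇝ v → v ⇝ u → root u ≡ root v
  root-cong {u} {v} uv vu with firstTrue-true (λ w → strong w u) (strong⁺ (⇝-refl u) (⇝-refl u))
  ... | j , first≡j , _ = begin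
    fromMaybe u (firstTrue (λ w → strong w u)) ≡⟨ cong (fromMaybe u) first≡j ⟩
    j                                          ≡⟨ cong (fromMaybe v) (trans (sym (firstTrue-cong same)) first≡j) ⟨
    fromMaybe v (firstTrue (λ w → strong w v)) ∎
    where
      open ≡-Reasoning
      same : ∀ w → strong w u ≡ strong w v
      same w = true⇔⇒≡
        (λ s → let wu , uw = strong⁻ s in strong⁺ (⇝-trans wu uv) (⇝-trans vu uw))
        (λ s → let wv , vw = strong⁻ s in strong⁺ (⇝-trans wv vu) (⇝-trans uv vw))

  outLevel inLevel : V → ℕ
  outLevel v = Out.dist (root v) v
  inLevel  v = In.dist (root v) v

  Class : Set
  Class = V × Fin (suc (suc (n D))) × Fin (suc (suc (n D)))

  class : V → Class
  class v = root v , fromℕ< (s≤s (Out.dist≤ (root v) v)) , fromℕ< (s≤s (In.dist≤ (root v) v))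

  _≟ᶜ_ : DecidableEquality Class
  _≟ᶜ_ = ≡-dec _≟_ (≡-dec _≟_ _≟_)

  class-≡ : ∀ {u v} → root u ≡ root v → outLevel u ≡ outLevel v → inLevel u ≡ inLevel v → class u ≡ class v
  class-≡ r o i = cong₂ _,_ r (cong₂ _,_ (fromℕ<-cong _ _ o _ _) (fromℕ<-cong _ _ i _ _))

  class⇒root : ∀ {u v} → class u ≡ class v → root u ≡ root v
  class⇒root = cong proj₁

  class⇒outLevel : ∀ {u v} → class u ≡ class v → outLevel u ≡ outLevel v
  class⇒outLevel {u} {v} eq = begin
    outLevel u                   ≡⟨ toℕ-fromℕ< _ ⟨
    toℕ (proj₁ (proj₂ (class u))) ≡⟨ cong (toℕ ∘ proj₁ ∘ proj₂) eq ⟩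
    toℕ (proj₁ (proj₂ (class v))) ≡⟨ toℕ-fromℕ< _ ⟩
    outLevel v                   ∎
    where open ≡-Reasoning

  class⇒inLevel : ∀ {u v} → class u ≡ class v → inLevel u ≡ inLevel v
  class⇒inLevel {u} {v} eq = begin
    inLevel u                    ≡⟨ toℕ-fromℕ< _ ⟨
    toℕ (proj₂ (proj₂ (class u))) ≡⟨ cong (toℕ ∘ proj₂ ∘ proj₂) eq ⟩
    toℕ (proj₂ (proj₂ (class v))) ≡⟨ toℕ-fromℕ< _ ⟩
    inLevel v                    ∎
    where open ≡-Reasoning

  levelParity : V → Fin (2 * 2)
  levelParity v = combine (parity (outLevel v)) (parity (inLevel v))

  -- Levels change by at most one along an arc, so equal parities leave only the monotone options.
  arc-levels : ∀ {u v} → arc D u v ≡ true → root u ≡ root v → levelParity u ≡ levelParity v →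
               outLevel v ≤ outLevel u × inLevel u ≤ inLevel v
  arc-levels {u} {v} uv ru≡rv same with combine-injective _ _ _ _ same
  ... | out-same , in-same =
        ≤-suc-parity (subst (λ r → Out.dist r v ≤ suc (outLevel u)) ru≡rv (Out.dist-arc (root⇝ u) uv)) out-same ,
        ≤-suc-parity (subst (λ r → In.dist r u ≤ suc (inLevel v)) (sym ru≡rv) (In.dist-arc (root⇝ᶜ v) uv)) (sym in-same)

  module _ (C : V → Set) (C-parity : ∀ {u w} → C u → C w → levelParity u ≡ levelParity w) (v₀ : V) where

    private
      InClass : V → Set
      InClass z = C z × class z ≡ class v₀

      pinched : ∀ {z} → C z → v₀ ⇝ z → z ⇝ v₀ → outLevel z ≡ outLevel v₀ → inLevel z ≡ inLevel v₀ → InClass z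
      pinched Cz v₀z zv₀ o i = Cz , class-≡ (root-cong zv₀ v₀z) o i

      arc-levels′ : ∀ {u v} → C u → C v → arc D u v ≡ true → v₀ ⇝ u → v ⇝ v₀ →
                    outLevel v ≤ outLevel u × inLevel u ≤ inLevel v
      arc-levels′ Cu Cv uv v₀u vv₀ =
        arc-levels uv (trans (root-cong (⇝-trans (⇝-snoc (⇝-refl _) uv) vv₀) v₀u)
                             (sym (root-cong vv₀ (⇝-snoc v₀u uv))))
                      (C-parity Cu Cv)

    -- Along a walk in C inside the strong component of v₀ the out-level never rises and the
    -- in-level never drops; bounds at the two ends in terms of v₀ therefore pin every vertex.
    walk-pinched : ∀ {u w} → Walk D C u w → v₀ ⇝ u → w ⇝ v₀ →
                   outLevel u ≤ outLevel v₀ → outLevel v₀ ≤ outLevel w →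
                   inLevel v₀ ≤ inLevel u → inLevel w ≤ inLevel v₀ → Walk D InClass u w
    walk-pinched wlk@(edge Cu Cw uw) v₀u wv₀ o₁ o₂ i₁ i₂ =
      let ow≤ou , iu≤iw = arc-levels′ Cu Cw uw v₀u wv₀ in
      edge (pinched Cu v₀u (⇝-trans (walk⇒⇝ wlk) wv₀)
                    (≤-antisym o₁ (≤-trans o₂ ow≤ou)) (≤-antisym (≤-trans iu≤iw i₂) i₁))
           (pinched Cw (⇝-trans v₀u (walk⇒⇝ wlk)) wv₀
                    (≤-antisym (≤-trans ow≤ou o₁) o₂) (≤-antisym i₂ (≤-trans i₁ iu≤iw)))
           uw
    walk-pinched wlk@(cons Cu uv rest) v₀u wv₀ o₁ o₂ i₁ i₂ =
      let ov≤ou , iu≤iv = arc-levels′ Cu (walk-head rest) uv v₀u (⇝-trans (walk⇒⇝ rest) wv₀)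
          rest′ = walk-pinched rest (⇝-snoc v₀u uv) wv₀ (≤-trans ov≤ou o₁) o₂ (≤-trans i₁ iu≤iv) i₂
          v~v₀ = proj₂ (walk-head rest′)
      in cons (pinched Cu v₀u (⇝-trans (walk⇒⇝ wlk) wv₀)
                       (≤-antisym o₁ (≤-trans (≤-reflexive (sym (class⇒outLevel v~v₀))) ov≤ou))
                       (≤-antisym (≤-trans iu≤iv (≤-reflexive (class⇒inLevel v~v₀))) i₁))
              uv rest′

  cycle-in-class : (C : V → Set) → (∀ {u w} → C u → C w → levelParity u ≡ levelParity w) →
                   ∀ v → Walk D C v v → Walk D (λ z → C z × class z ≡ class v) v v
  cycle-in-class C C-parity v cycle = walk-pinched C C-parity v cycle (⇝-refl v) (⇝-refl v) ≤-refl ≤-refl ≤-refl ≤-refl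

  outLevel-root : ∀ {v} → v ≡ root v → outLevel v ≡ 0
  outLevel-root {v} v≡r = trans (cong (Out.dist (root v)) v≡r) (Out.dist-self (root v))

  root-in-class : ∀ {u w} → class u ≡ class w → w ≡ root w → u ≡ root u
  root-in-class {u} {w} uw w≡r = Out.dist-zero (root⇝ u) (trans (class⇒outLevel uw) (outLevel-root w≡r))

  path-via-root : ∀ {v₁ v₂} → class v₁ ≡ class v₂ → v₁ ≢ root v₁ →
                  In.ShortPath (root v₁) (inLevel v₁) v₁ → ShortPath (root v₁) (outLevel v₂) v₂ →
                  ∃ λ zs → IsPathThrough D v₁ zs v₂ × (∀ {w} → w ∈ zs → class w ≢ class v₁)
  path-via-root {v₁} {v₂} same v₁-not-root (zs₁ , rv₁ , near₁) (zs₂ , rv₂ , near₂) =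
    reverse zs₁ ++ root v₁ ∷ zs₂ , path-++ D (reverse zs₁) zs₂ (path-reverse D zs₁ rv₁) rv₂ , outside
    where
      outside : ∀ {w} → w ∈ reverse zs₁ ++ root v₁ ∷ zs₂ → class w ≢ class v₁
      outside {w} w∈ w~v₁ with ∈-++⁻ (reverse zs₁) w∈
      ... | inj₁ w∈zs₁ = <-irrefl in-equal (All.lookup near₁ (reverse⁻ w∈zs₁))
        where
          in-equal : In.dist (root v₁) w ≡ inLevel v₁
          in-equal = trans (cong (λ s → In.dist s w) (sym (class⇒root w~v₁))) (class⇒inLevel w~v₁)
      ... | inj₂ (here w≡r) = v₁-not-root (root-in-class (sym w~v₁) (trans w≡r (class⇒root (sym w~v₁))))
      ... | inj₂ (there w∈zs₂) = <-irrefl out-equal (All.lookup near₂ w∈zs₂)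
        where
          out-equal : Out.dist (root v₁) w ≡ outLevel v₂
          out-equal = trans (cong (λ s → Out.dist s w) (sym (class⇒root w~v₁)))
                            (class⇒outLevel (trans w~v₁ same))

  bypass : ∀ {v₁ v₂} → class v₁ ≡ class v₂ → v₁ ≢ v₂ →
           ∃ λ zs → IsPathThrough D v₁ zs v₂ × (∀ {w} → w ∈ zs → class w ≢ class v₁)
  bypass {v₁} {v₂} same v₁≢v₂ =
    path-via-root same v₁-not-root
      (In.shortest-path (root⇝ᶜ v₁) v₁-not-root)
      (subst (λ r → ShortPath r (outLevel v₂) v₂) (sym (class⇒root same))
             (Out.shortest-path (root⇝ v₂) (v₁-not-root ∘ root-in-class same)))
    where
      v₁-not-root : v₁ ≢ root v₁
      v₁-not-root v₁≡r = v₁≢v₂ (trans v₁≡r (trans (class⇒root same) (sym (root-in-class (sym same) v₁≡r))))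

  simple-bypass : ∀ {v₁ v₂} → class v₁ ≡ class v₂ → v₁ ≢ v₂ →
                  ∃ λ zs → SimplePath D v₁ zs v₂ × (∀ {w} → w ∈ zs → class w ≢ class v₁)
  simple-bypass {v₁} {v₂} same v₁≢v₂ = shorten (bypass same v₁≢v₂)
    where
      shorten : (∃ λ zs → IsPathThrough D v₁ zs v₂ × (∀ {w} → w ∈ zs → class w ≢ class v₁)) →
                ∃ λ zs → SimplePath D v₁ zs v₂ × (∀ {w} → w ∈ zs → class w ≢ class v₁)
      shorten (zs , v₁v₂ , outside) =
        let zs′ , simple , zs′⊆zs = simple-path D v₁ zs v₂ v₁v₂ v₁≢v₂ in zs′ , simple , outside ∘ zs′⊆zs

  module Class = Fibre D _≟ᶜ_ class

  uncolourable-class : ∀ c → DichromaticAtLeast D (suc (4 * c)) → ∃ λ t → ¬ Dicolourable (Class.induced t) c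
  uncolourable-class c χD =
    from-decision (any? (λ r → any? (λ i → any? (λ j → ¬? (dicolourable? (Class.induced (r , i , j)) c)))))
    where
      from-decision : Dec (∃ λ r → ∃ λ i → ∃ λ j → ¬ Dicolourable (Class.induced (r , i , j)) c) →
                      ∃ λ t → ¬ Dicolourable (Class.induced t) c
      from-decision (yes (r , i , j , ¬col)) = (r , i , j) , ¬col
      from-decision (no none) =
        contradiction (dicolourable-by-fibres D _≟ᶜ_ class levelParity cycle-in-class
                         λ { (r , i , j) → decidable-stable (dicolourable? _ c) (λ ¬col → none (r , i , j , ¬col)) })
                      (χD (4 * c) ≤-refl)

deleteArc-arc : ∀ (F : Digraph) (x y : Fin (n F)) {a b} → arc F a b ≡ true → ¬ (a ≡ x × b ≡ y) →
                arc (deleteArc F x y) a b ≡ true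
deleteArc-arc F x y {a} {b} ab ¬xy rewrite ab with a ≟ x | b ≟ y
... | yes a≡x | yes b≡y = contradiction (a≡x , b≡y) ¬xy
... | yes _   | no  _   = refl
... | no  _   | yes _   = refl
... | no  _   | no  _   = refl

module _ {F H D : Digraph} (ι : Fin (n H) → Fin (n D)) (ι-injective : ∀ {i j} → ι i ≡ ι j → i ≡ j)
         (ι-arc : ∀ {i j} → arc H i j ≡ true → arc D (ι i) (ι j) ≡ true) where

  path-map : ∀ {a b} zs → IsPathThrough H a zs b → IsPathThrough D (ι a) (map ι zs) (ι b)
  path-map []       ab        = ι-arc ab
  path-map (z ∷ zs) (az , zb) = ι-arc az , path-map zs zb

  subdivision-map : ContainsSubdivision F H → ContainsSubdivision F D
  subdivision-map S = record
    { φ      = ι ∘ φ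
    ; φ-inj  = φ-inj ∘ ι-injective
    ; P      = λ a b e → map ι (P a b e)
    ; path   = λ a b e → path-map (P a b e) (path a b e)
    ; unique = λ a b e → map⁺ ι-injective (unique a b e)
    ; avoid  = λ a b e w w∈ v w≡ → let z , z∈ , w≡ιz = ∈-map⁻ ι w∈ in
                 avoid a b e z z∈ v (ι-injective (trans (sym w≡ιz) w≡))
    ; disj   = λ a b e a′ b′ e′ ab≢ w w∈ w∈′ →
                 let z , z∈ , w≡ιz = ∈-map⁻ ι w∈ ; z′ , z∈′ , w≡ιz′ = ∈-map⁻ ι w∈′ in
                 disj a b e a′ b′ e′ ab≢ z z∈ (subst (_∈ P a′ b′ e′) (ι-injective (trans (sym w≡ιz′) w≡ιz)) z∈′)
    }
    where open ContainsSubdivision S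

subdivision-add-arc :
  ∀ (F D : Digraph) (x y : Fin (n F)) (X : Fin (n D) → Set) (S : ContainsSubdivision (deleteArc F x y) D) →
  let open ContainsSubdivision S in
  (∀ v → X (φ v)) → (∀ a b e {w} → w ∈ P a b e → X w) →
  ∀ zs → IsPathThrough D (φ x) zs (φ y) → Unique zs → (∀ {w} → w ∈ zs → ¬ X w) →
  ContainsSubdivision F D
subdivision-add-arc F D x y X S φ∈X P⊆X zs xy uniq outside = record
  { φ      = φ
  ; φ-inj  = φ-inj
  ; P      = λ a b e → P′ a b e (is-xy a b)
  ; path   = λ a b e → path′ a b e (is-xy a b)
  ; unique = λ a b e → unique′ a b e (is-xy a b)
  ; avoid  = λ a b e → avoid′ a b e (is-xy a b)
  ; disj   = λ a b e a′ b′ e′ → disj′ a b e (is-xy a b) a′ b′ e′ (is-xy a′ b′)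
  }
  where
    open ContainsSubdivision S

    is-xy : ∀ a b → Dec (a ≡ x × b ≡ y)
    is-xy a b = (a ≟ x) ×-dec (b ≟ y)

    P′ : ∀ a b → arc F a b ≡ true → Dec (a ≡ x × b ≡ y) → List (Fin (n D))
    P′ a b e (yes _)  = zs
    P′ a b e (no ¬xy) = P a b (deleteArc-arc F x y e ¬xy)

    path′ : ∀ a b e d → IsPathThrough D (φ a) (P′ a b e d) (φ b)
    path′ a b e (yes (refl , refl)) = xy
    path′ a b e (no ¬xy)            = path a b (deleteArc-arc F x y e ¬xy)

    unique′ : ∀ a b e d → Unique (P′ a b e d)
    unique′ a b e (yes _)  = uniq
    unique′ a b e (no ¬xy) = unique a b (deleteArc-arc F x y e ¬xy)

    avoid′ : ∀ a b e d w → w ∈ P′ a b e d → ∀ v → ¬ (w ≡ φ v)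
    avoid′ a b e (yes _)  w w∈ v refl = outside w∈ (φ∈X v)
    avoid′ a b e (no ¬xy) w w∈ v      = avoid a b (deleteArc-arc F x y e ¬xy) w w∈ v

    disj′ : ∀ a b e d a′ b′ e′ d′ → ¬ (a ≡ a′ × b ≡ b′) → ∀ w → w ∈ P′ a b e d → ¬ (w ∈ P′ a′ b′ e′ d′)
    disj′ a b e (yes (refl , refl)) a′ b′ e′ (yes (refl , refl)) ab≢ w _ _ = ab≢ (refl , refl)
    disj′ a b e (yes _)  a′ b′ e′ (no ¬xy′) _ w w∈ w∈′ = outside w∈ (P⊆X a′ b′ _ w∈′)
    disj′ a b e (no ¬xy) a′ b′ e′ (yes _)   _ w w∈ w∈′ = outside w∈′ (P⊆X a b _ w∈)
    disj′ a b e (no ¬xy) a′ b′ e′ (no ¬xy′) ab≢ w w∈ w∈′ =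
      disj a b (deleteArc-arc F x y e ¬xy) a′ b′ (deleteArc-arc F x y e′ ¬xy′) ab≢ w w∈ w∈′

module _ (F : Digraph) (x y : Fin (n F)) (xy : arc F x y ≡ true) (D : Digraph) where

  open Levels D

  subdivision-in-class : ∀ c → Forces (deleteArc F x y) (suc c) →
                         ∀ t → ¬ Dicolourable (Class.induced t) c → ContainsSubdivision F D
  subdivision-in-class c forces t ¬col = extend (simple-bypass (trans (φ∈t x) (sym (φ∈t y))) φx≢φy)
    where
      open Class t using (induced; ι; ι-injective; ι-fibre)

      S₀ : ContainsSubdivision (deleteArc F x y) induced
      S₀ = forces induced λ { k (s≤s k≤c) col → ¬col (dicolourable-mono induced k≤c col) }

      S : ContainsSubdivision (deleteArc F x y) D
      S = subdivision-map ι ι-injective (λ ij → ij) S₀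

      open ContainsSubdivision S using (φ; φ-inj; P)

      φ∈t : ∀ v → class (φ v) ≡ t
      φ∈t v = ι-fibre _

      P⊆t : ∀ a b e {w} → w ∈ P a b e → class w ≡ t
      P⊆t a b e w∈ = let z , _ , w≡ιz = ∈-map⁻ ι w∈ in subst (λ w → class w ≡ t) (sym w≡ιz) (ι-fibre z)

      φx≢φy : φ x ≢ φ y
      φx≢φy φx≡φy = true≢false (subst (λ v → arc F x v ≡ true) (sym (φ-inj φx≡φy)) xy) (loopless F x)

      extend : (∃ λ zs → SimplePath D (φ x) zs (φ y) × (∀ {w} → w ∈ zs → class w ≢ class (φ x))) →
               ContainsSubdivision F D
      extend (zs , (φxφy , uniq , _ , _) , outside) =
        subdivision-add-arc F D x y (λ w → class w ≡ t) S φ∈t P⊆t zs φxφy uniq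
          (λ w∈ w∈t → outside w∈ (trans w∈t (sym (φ∈t x))))

forces-after-adding-arc : ∀ (F : Digraph) (x y : Fin (n F)) → arc F x y ≡ true →
                          ∀ c → Forces (deleteArc F x y) c → Forces F (4 * c ∸ 3)
forces-after-adding-arc F x y xy zero    forces D _  = no-vertex (ContainsSubdivision.φ (forces empty λ _ ()) x)
  where
    empty : Digraph
    empty = record { n = 0 ; arc = λ () ; loopless = λ () }
    no-vertex : Fin 0 → ContainsSubdivision F D
    no-vertex ()
forces-after-adding-arc F x y xy (suc c) forces D χD =
  let t , ¬col = Levels.uncolourable-class D c (subst (DichromaticAtLeast D) (cong (_∸ 3) (*-suc 4 c)) χD)
  in subdivision-in-class F x y xy D c forces t ¬col

lemma31 : (F : Digraph) (x y : Fin (n F)) → arc F x y ≡ true →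
          (c : ℕ) → IsMad (deleteArc F x y) c →
          Maderian F × (∀ d → IsMad F d → d ≤ 4 * c ∸ 3)
lemma31 F x y xy c (forces , _) = (4 * c ∸ 3 , forces-F) , λ d (_ , minimal) → minimal (4 * c ∸ 3) forces-F
  where
    forces-F : Forces F (4 * c ∸ 3)
    forces-F = forces-after-adding-arc F x y xy c forces
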